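{- There exists a sequence of finite simple graphs $\{G_n\}_{n\ge 1}$ such that $\mathrm{scc}'(G_n)/\mathrm{scc}(G_n)\to\infty$ as $n\to\infty$.
   Context: All graphs are finite, simple and undirected. A clique of a graph $G$ is a set of pairwise adjacent vertices; its size is its number of vertices. A clique covering of $G$ is a family of cliques of $G$ such that every edge of $G$ lies in at least one of them. The clique cover number $\mathrm{cc}(G)$ is the minimum number of cliques in a clique covering of $G$. The sigma clique cover number $\mathrm{scc}(G)$ is the minimum of $\sum_{C\in\mathcal{C}}|C|$ over all clique coverings $\mathcal{C}$ of $G$. Further, $\mathrm{scc}'(G)=\min\{\sum_{C\in\mathcal{C}}|C| : \mathcal{C}\text{ a clique covering of } G \text{ with } |\mathcal{C}|=\mathrm{cc}(G)\}$. -}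

module Defs where

open import Data.Nat using (ℕ; _+_; _*_; _≤_; _<_)
open import Data.Fin using (Fin)
open import Data.Fin.Subset using (Subset; _∈_; ∣_∣)
open import Data.Bool using (Bool; true; false)
open import Data.List using (List; length; map)
open import Data.Nat.ListAction using (sum)
open import Data.List.Relation.Unary.All using (All)
open import Data.List.Relation.Unary.Any using (Any)
open import Data.Product using (Σ; _×_; ∃-syntax)
open import Relation.Binary.PropositionalEquality using (_≡_; _≢_)

record Graph : Set where
  field
    order  : ℕ
    adj    : Fin order → Fin order → Bool
    adj-sym    : ∀ u v → adj u v ≡ adj v u
    adj-irrefl : ∀ v → adj v v ≡ false
open Graph public

IsClique : (G : Graph) → Subset (order G) → Set
IsClique G C = ∀ u v → u ∈ C → v ∈ C → u ≢ v → adj G u v ≡ true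

IsCliqueCovering : (G : Graph) → List (Subset (order G)) → Set
IsCliqueCovering G 𝒞 =
  All (IsClique G) 𝒞 ×
  (∀ u v → adj G u v ≡ true → Any (λ C → u ∈ C × v ∈ C) 𝒞)

weight : ∀ {n} → List (Subset n) → ℕ
weight 𝒞 = sum (map ∣_∣ 𝒞)

IsCC : Graph → ℕ → Set
IsCC G k =
  (∃[ 𝒞 ] (IsCliqueCovering G 𝒞 × length 𝒞 ≡ k)) ×
  (∀ 𝒞 → IsCliqueCovering G 𝒞 → k ≤ length 𝒞)

IsSCC : Graph → ℕ → Set
IsSCC G k =
  (∃[ 𝒞 ] (IsCliqueCovering G 𝒞 × weight 𝒞 ≡ k)) ×
  (∀ 𝒞 → IsCliqueCovering G 𝒞 → k ≤ weight 𝒞)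

IsSCC' : Graph → ℕ → Set
IsSCC' G k = ∃[ c ] (IsCC G c ×
  (∃[ 𝒞 ] (IsCliqueCovering G 𝒞 × length 𝒞 ≡ c × weight 𝒞 ≡ k)) ×
  (∀ 𝒞 → IsCliqueCovering G 𝒞 → length 𝒞 ≡ c → k ≤ weight 𝒞))

module Submission where

-- Let R be a clique on r vertices, X = {x₀, …, x_{K-1}} and Y = {y₀, …, y_{K-1}} (K ≥ 2) cliques
-- joined by the perfect matching xᵢyᵢ, and join R to all of Y and to X ∖ {x₀}. A clique through
-- xᵢyᵢ meets X ∪ Y only in {xᵢ, yᵢ}, so the K matching edges together with x₀x₁ and y₀y₁ need
-- K + 2 distinct cliques; the cliques X, R ∪ Y and the spokes {xᵢ, yᵢ} ∪ R (i ≠ 0), {x₀, y₀} show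
-- that cc = K + 2. With only K + 2 cliques there is no room left for the edges ρxᵢ (ρ ∈ R,
-- i ≠ 0): they must lie in the clique of xᵢyᵢ, which therefore contains R, so every minimum
-- covering has weight at least (K − 1) r. On the other hand R ∪ Y, R ∪ X ∖ {x₀}, X and the
-- matching edges cover everything with weight O(r + K). Taking r = n + 1 and K = n + 2 gives
-- scc ≤ 19 (n + 1) and scc' ≥ (n + 1)².

open import Defs
open import Data.Nat using (ℕ; zero; suc; _+_; _*_; _≤_; _<_; z≤n; s≤s)
open import Data.Nat.Properties
  using (_≟_; ≤-reflexive; ≤-trans; ≮⇒≥; ≤⇒≯; n≤1+n; m≤n⇒m≤1+n; m≤m+n; m≤n+m; +-suc; +-mono-≤;
         +-monoʳ-≤; *-monoˡ-≤; *-monoʳ-≤; *-assoc; *-comm; anyUpTo?; +-0-commutativeMonoid; module ≤-Reasoning)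
open import Data.Nat.Induction using (<-rec)
open import Data.Nat.Tactic.RingSolver using (solve-∀)
open import Algebra.Properties.CommutativeMonoid.Sum +-0-commutativeMonoid
  using (sum; sum-remove; sum-cong-≗)
open import Data.Product using (_×_; Σ; Σ-syntax; ∃-syntax; _,_; proj₁; proj₂)
open import Data.Sum using (inj₁; inj₂; [_,_]′)
open import Data.Empty using (⊥-elim)
open import Data.Bool using (Bool; true; false; not)
import Data.Bool as Bool
open import Data.Fin as Fin using (Fin; zero; suc; _↑ˡ_; _↑ʳ_; splitAt; punchOut)
import Data.Fin.Properties as Finₚ
open import Data.Fin.Subset using (Subset; _∈_; ∣_∣; _∪_; ⁅_⁆; Nonempty; Empty)
open import Data.Fin.Subset.Properties
  using (_∈?_; anySubset?; nonempty?; Empty-unique; ∣⊥∣≡0; x∈p⇒∣p-x∣<∣p∣; drop-there;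
         x∈p∪q⁻; x∈p∪q⁺; x∈⁅x⁆; x∈⁅y⁆⇒x≡y; ∣⁅x⁆∣≡1; ∣p∣≤n)
import Data.Vec as Vec
open import Data.Vec using ([]; _∷_)
open import Data.Vec.Functional using (Vector; removeAt)
import Data.Vec.Properties as Vecₚ
open import Data.List using (List; []; _∷_; length; filter; tabulate; lookup)
open import Data.List.Properties using (length-tabulate)
open import Data.List.Relation.Unary.All as All using (All; []; _∷_)
import Data.List.Relation.Unary.All.Properties as Allₚ
open import Data.List.Relation.Unary.Any as Any using (Any; here; there)
import Data.List.Relation.Unary.Any.Properties as Anyₚ
open import Data.List.Membership.Propositional.Properties using (∈-lookup)
open import Function using (_∘_)
open import Function.Definitions using (Injective)
open import Function.Bundles using (mk⇔)
open import Relation.Unary using (Decidable)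
open import Relation.Nullary using (Dec; yes; no; ¬?; does; contradiction)
open import Relation.Nullary.Decidable
  using (map′; _×-dec_; _→-dec_; _⊎-dec_; dec-true; dec-false; does-⇔)
open import Relation.Binary.PropositionalEquality
  using (_≡_; _≢_; refl; sym; trans; cong; cong₂; subst)

Minimum : (ℕ → Set) → ℕ → Set
Minimum P k = P k × (∀ {j} → P j → k ≤ j)

minimum : ∀ {P : ℕ → Set} → Decidable P → ∀ {w} → P w → Σ ℕ (Minimum P)
minimum {P} P? {w} = <-rec (λ w → P w → Σ ℕ (Minimum P)) step w
  where
  step : ∀ w → (∀ {v} → v < w → P v → Σ ℕ (Minimum P)) → P w → Σ ℕ (Minimum P)
  step w below Pw with anyUpTo? P? w
  ... | yes (v , v<w , Pv) = below v<w Pv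
  ... | no  none           = w , Pw , λ {j} Pj → ≮⇒≥ (λ j<w → none (j , j<w , Pj))

*≤sum : ∀ {n c} (f : Vector ℕ n) → (∀ i → c ≤ f i) → n * c ≤ sum f
*≤sum {zero}  f c≤f = z≤n
*≤sum {suc n} f c≤f = +-mono-≤ (c≤f zero) (*≤sum (f ∘ suc) (c≤f ∘ suc))

sum-injective-≤ : ∀ {k n} (f : Vector ℕ n) (h : Fin k → Fin n) →
                  Injective _≡_ _≡_ h → sum (f ∘ h) ≤ sum f
sum-injective-≤ {zero}           _ _ _     = z≤n
sum-injective-≤ {suc k} {zero}   _ h _     with h zero
... | ()
sum-injective-≤ {suc k} {suc n}  f h h-inj = begin
  f j + sum (f ∘ h ∘ suc)
    ≡⟨ cong (f j +_) (sum-cong-≗ λ i → cong f (sym (Finₚ.punchIn-punchOut (j≢ i)))) ⟩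
  f j + sum (removeAt f j ∘ h′)
    ≤⟨ +-monoʳ-≤ (f j) (sum-injective-≤ (removeAt f j) h′ h′-inj) ⟩
  f j + sum (removeAt f j)
    ≡⟨ sym (sum-remove f) ⟩
  sum f ∎
  where
  open ≤-Reasoning
  j = h zero
  j≢ : ∀ i → j ≢ h (suc i)
  j≢ i eq with h-inj eq
  ... | ()
  h′ : Fin k → Fin n
  h′ i = punchOut (j≢ i)
  h′-inj : Injective _≡_ _≡_ h′
  h′-inj {a} {b} eq = Finₚ.suc-injective (h-inj (Finₚ.punchOut-injective (j≢ a) (j≢ b) eq))

injective⇒surjective : ∀ {k n} (g : Fin k → Fin n) → Injective _≡_ _≡_ g → n ≤ k →
                       ∀ j → ∃[ t ] g t ≡ j
injective⇒surjective {k} {n} g g-inj n≤k j with Finₚ.any? (λ t → g t Fin.≟ j)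
... | yes hit  = hit
... | no  miss = contradiction (Finₚ.injective⇒≤ g′-inj) (≤⇒≯ n≤k)
  where
  g′ : Fin (suc k) → Fin n
  g′ zero    = j
  g′ (suc t) = g t
  g′-inj : Injective _≡_ _≡_ g′
  g′-inj {zero}  {zero}  _  = refl
  g′-inj {zero}  {suc t} eq = ⊥-elim (miss (t , sym eq))
  g′-inj {suc t} {zero}  eq = ⊥-elim (miss (t , eq))
  g′-inj {suc s} {suc t} eq = cong suc (g-inj eq)

Empty⇒∣p∣≡0 : ∀ {n} {p : Subset n} → Empty p → ∣ p ∣ ≡ 0
Empty⇒∣p∣≡0 {n} empty = trans (cong ∣_∣ (Empty-unique empty)) (∣⊥∣≡0 n)

Nonempty⇒1≤∣p∣ : ∀ {n} {p : Subset n} → Nonempty p → 1 ≤ ∣ p ∣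
Nonempty⇒1≤∣p∣ (x , x∈p) = ≤-trans (s≤s z≤n) (x∈p⇒∣p-x∣<∣p∣ x∈p)

∣p∪q∣≤∣p∣+∣q∣ : ∀ {n} (p q : Subset n) → ∣ p ∪ q ∣ ≤ ∣ p ∣ + ∣ q ∣
∣p∪q∣≤∣p∣+∣q∣ []          []          = z≤n
∣p∪q∣≤∣p∣+∣q∣ (true ∷ p)  (true ∷ q)  = s≤s (≤-trans (∣p∪q∣≤∣p∣+∣q∣ p q) (+-monoʳ-≤ ∣ p ∣ (n≤1+n _)))
∣p∪q∣≤∣p∣+∣q∣ (true ∷ p)  (false ∷ q) = s≤s (∣p∪q∣≤∣p∣+∣q∣ p q)
∣p∪q∣≤∣p∣+∣q∣ (false ∷ p) (true ∷ q)  rewrite +-suc ∣ p ∣ ∣ q ∣ = s≤s (∣p∪q∣≤∣p∣+∣q∣ p q)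
∣p∪q∣≤∣p∣+∣q∣ (false ∷ p) (false ∷ q) = ∣p∪q∣≤∣p∣+∣q∣ p q

↑ˡ-all∈⇒m≤∣p∣ : ∀ {m k} (p : Subset (m + k)) → (∀ i → i ↑ˡ k ∈ p) → m ≤ ∣ p ∣
↑ˡ-all∈⇒m≤∣p∣ {zero}  p           _      = z≤n
↑ˡ-all∈⇒m≤∣p∣ {suc m} (true ∷ p)  all∈p = s≤s (↑ˡ-all∈⇒m≤∣p∣ p (drop-there ∘ all∈p ∘ suc))
↑ˡ-all∈⇒m≤∣p∣ {suc m} (false ∷ p) all∈p with all∈p zero
... | ()

weight≡sum : ∀ {n} (𝒞 : List (Subset n)) → weight 𝒞 ≡ sum (λ j → ∣ lookup 𝒞 j ∣)
weight≡sum []      = refl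
weight≡sum (C ∷ 𝒞) = cong (∣ C ∣ +_) (weight≡sum 𝒞)

weight-tabulate-≤ : ∀ {n k c} (f : Fin k → Subset n) → (∀ i → ∣ f i ∣ ≤ c) →
                    weight (tabulate f) ≤ k * c
weight-tabulate-≤ {k = zero}  f ∣f∣≤c = z≤n
weight-tabulate-≤ {k = suc k} f ∣f∣≤c =
  +-mono-≤ (∣f∣≤c zero) (weight-tabulate-≤ (f ∘ suc) (∣f∣≤c ∘ suc))

weight-filter-nonempty : ∀ {n} (𝒞 : List (Subset n)) → weight (filter nonempty? 𝒞) ≡ weight 𝒞
weight-filter-nonempty []      = refl
weight-filter-nonempty (C ∷ 𝒞) with nonempty? C
... | yes _     = cong (∣ C ∣ +_) (weight-filter-nonempty 𝒞)
... | no  empty = trans (weight-filter-nonempty 𝒞) (cong (_+ weight 𝒞) (sym (Empty⇒∣p∣≡0 empty)))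

member⇒0<weight : ∀ {n} {x : Fin n} {𝒞 : List (Subset n)} → Any (x ∈_) 𝒞 → 0 < weight 𝒞
member⇒0<weight {𝒞 = C ∷ 𝒞} (here x∈C) = ≤-trans (Nonempty⇒1≤∣p∣ (_ , x∈C)) (m≤m+n ∣ C ∣ (weight 𝒞))
member⇒0<weight {𝒞 = C ∷ 𝒞} (there p)  = ≤-trans (member⇒0<weight p) (m≤n+m (weight 𝒞) ∣ C ∣)

length≤weight : ∀ {n} {𝒞 : List (Subset n)} → All Nonempty 𝒞 → length 𝒞 ≤ weight 𝒞
length≤weight []           = z≤n
length≤weight (ne ∷ all-ne) = +-mono-≤ (Nonempty⇒1≤∣p∣ ne) (length≤weight all-ne)

∃-short-list? : ∀ {n} (Q : List (Subset n) → Set) → Decidable Q →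
                ∀ ℓ → Dec (∃[ 𝒞 ] (length 𝒞 ≤ ℓ × Q 𝒞))
∃-short-list? Q Q? zero = map′ (λ q → [] , z≤n , q) (λ { ([] , _ , q) → q ; (_ ∷ _ , () , _) }) (Q? [])
∃-short-list? Q Q? (suc ℓ) = map′
  (λ { (inj₁ q) → [] , z≤n , q ; (inj₂ (C , 𝒞 , ℓ𝒞 , q)) → C ∷ 𝒞 , s≤s ℓ𝒞 , q })
  (λ { ([] , _ , q) → inj₁ q ; (C ∷ 𝒞 , s≤s ℓ𝒞 , q) → inj₂ (C , 𝒞 , ℓ𝒞 , q) })
  (Q? [] ⊎-dec anySubset? (λ C → ∃-short-list? (Q ∘ (C ∷_)) (Q? ∘ (C ∷_)) ℓ))

-- Clique coverings of an arbitrary graph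

module _ (G : Graph) where

  isClique? : Decidable (IsClique G)
  isClique? C = Finₚ.all? λ u → Finₚ.all? λ v →
    (u ∈? C) →-dec ((v ∈? C) →-dec ((¬? (u Fin.≟ v)) →-dec (adj G u v Bool.≟ true)))

  isCliqueCovering? : Decidable (IsCliqueCovering G)
  isCliqueCovering? 𝒞 = All.all? isClique? 𝒞 ×-dec (Finₚ.all? λ u → Finₚ.all? λ v →
    (adj G u v Bool.≟ true) →-dec Any.any? (λ C → (u ∈? C) ×-dec (v ∈? C)) 𝒞)

  module _ {𝒞 : List (Subset (order G))} (cov : IsCliqueCovering G 𝒞) where

    shared-clique : ∀ {u v} → adj G u v ≡ true → Σ[ j ∈ Fin (length 𝒞) ] (u ∈ lookup 𝒞 j × v ∈ lookup 𝒞 j)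
    shared-clique {u} {v} uv = Any.index p , Anyₚ.lookup-result p
      where p = proj₂ cov u v uv

    same-clique⇒adjacent : ∀ {u v} j → u ∈ lookup 𝒞 j → v ∈ lookup 𝒞 j → u ≢ v → adj G u v ≡ true
    same-clique⇒adjacent {u} {v} j = All.lookup (proj₁ cov) (∈-lookup j) u v

    filter-nonempty-covering : IsCliqueCovering G (filter nonempty? 𝒞)
    filter-nonempty-covering = Allₚ.filter⁺ nonempty? (proj₁ cov) , λ u v uv → keep (proj₂ cov u v uv)
      where
      keep : ∀ {u v} → Any (λ C → u ∈ C × v ∈ C) 𝒞 → Any (λ C → u ∈ C × v ∈ C) (filter nonempty? 𝒞)
      keep {u} p with Anyₚ.filter⁺ nonempty? p
      ... | inj₁ q     = q
      ... | inj₂ empty = contradiction (u , proj₁ (Anyₚ.lookup-result p)) empty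

    weight-positive : ∀ u v → adj G u v ≡ true → 0 < weight 𝒞
    weight-positive u v uv = member⇒0<weight (Any.map proj₁ (proj₂ cov u v uv))

  -- Coverings of weight k may be assumed to have at most k cliques, which makes the search finite.
  ShortCoveringOfWeight : ℕ → Set
  ShortCoveringOfWeight k = ∃[ 𝒞 ] (length 𝒞 ≤ k × (IsCliqueCovering G 𝒞 × weight 𝒞 ≡ k))

  short-covering : ∀ {𝒞} → IsCliqueCovering G 𝒞 → ShortCoveringOfWeight (weight 𝒞)
  short-covering {𝒞} cov =
    filter nonempty? 𝒞 ,
    subst (length (filter nonempty? 𝒞) ≤_) (weight-filter-nonempty 𝒞)
          (length≤weight (Allₚ.all-filter nonempty? 𝒞)) ,
    filter-nonempty-covering cov , weight-filter-nonempty 𝒞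

  shortCoveringOfWeight? : Decidable ShortCoveringOfWeight
  shortCoveringOfWeight? k = ∃-short-list? _ (λ 𝒞 → isCliqueCovering? 𝒞 ×-dec (weight 𝒞 ≟ k)) k

  scc-exists : ∀ {𝒞} → IsCliqueCovering G 𝒞 → Σ ℕ (IsSCC G)
  scc-exists cov with minimum shortCoveringOfWeight? (short-covering cov)
  ... | k , (𝒞 , _ , cov𝒞 , w𝒞) , least = k , (𝒞 , cov𝒞 , w𝒞) , λ _ cov𝒟 → least (short-covering cov𝒟)

  CoveringOfSizeAndWeight : ℕ → ℕ → Set
  CoveringOfSizeAndWeight c k =
    ∃[ 𝒞 ] (length 𝒞 ≤ c × (IsCliqueCovering G 𝒞 × length 𝒞 ≡ c × weight 𝒞 ≡ k))

  coveringOfSizeAndWeight? : ∀ c → Decidable (CoveringOfSizeAndWeight c)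
  coveringOfSizeAndWeight? c k =
    ∃-short-list? _ (λ 𝒞 → isCliqueCovering? 𝒞 ×-dec ((length 𝒞 ≟ c) ×-dec (weight 𝒞 ≟ k))) c

  scc'-exists : ∀ {c} → IsCC G c → Σ ℕ (IsSCC' G)
  scc'-exists {c} cc@((𝒞₀ , cov₀ , l₀) , _)
    with minimum (coveringOfSizeAndWeight? c) (𝒞₀ , ≤-reflexive l₀ , cov₀ , l₀ , refl)
  ... | k , (𝒞 , _ , cov𝒞 , l𝒞 , w𝒞) , least =
    k , c , cc , (𝒞 , cov𝒞 , l𝒞 , w𝒞) , λ 𝒟 cov𝒟 l𝒟 → least (𝒟 , ≤-reflexive l𝒟 , cov𝒟 , l𝒟 , refl)

  scc'-witness : ∀ {k 𝒟} → IsSCC' G k → IsCliqueCovering G 𝒟 →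
                 ∃[ 𝒞 ] (IsCliqueCovering G 𝒞 × length 𝒞 ≤ length 𝒟 × weight 𝒞 ≡ k)
  scc'-witness (c , (_ , c-least) , (𝒞 , cov𝒞 , l𝒞 , w𝒞) , _) cov𝒟 =
    𝒞 , cov𝒞 , ≤-trans (≤-reflexive l𝒞) (c-least _ cov𝒟) , w𝒞

-- Graphs presented on a finite type of vertices

module Presentation
  {V : Set} (N : ℕ) (enc : V → Fin N) (dec : Fin N → V)
  (dec∘enc : ∀ a → dec (enc a) ≡ a) (enc∘dec : ∀ u → enc (dec u) ≡ u)
  (adjᵛ : V → V → Bool) (adjᵛ-sym : ∀ a b → adjᵛ a b ≡ adjᵛ b a) (adjᵛ-irrefl : ∀ a → adjᵛ a a ≡ false)
  where

  graph : Graph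
  graph = record
    { order      = N
    ; adj        = λ u v → adjᵛ (dec u) (dec v)
    ; adj-sym    = λ u v → adjᵛ-sym (dec u) (dec v)
    ; adj-irrefl = adjᵛ-irrefl ∘ dec
    }

  adj-enc : ∀ a b → adj graph (enc a) (enc b) ≡ adjᵛ a b
  adj-enc a b rewrite dec∘enc a | dec∘enc b = refl

  enc-injective : ∀ {a b} → a ≢ b → enc a ≢ enc b
  enc-injective a≢b eq = a≢b (trans (sym (dec∘enc _)) (trans (cong dec eq) (dec∘enc _)))

  ⟦_⟧ : (V → Bool) → Subset N
  ⟦ P ⟧ = Vec.tabulate (P ∘ dec)

  ∈⟦⟧⁺ : ∀ P a → P a ≡ true → enc a ∈ ⟦ P ⟧
  ∈⟦⟧⁺ P a Pa = Vecₚ.lookup⇒[]= (enc a) ⟦ P ⟧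
    (trans (Vecₚ.lookup∘tabulate (P ∘ dec) (enc a)) (trans (cong P (dec∘enc a)) Pa))

  both∈⟦⟧ : ∀ P a b → P a ≡ true → P b ≡ true → enc a ∈ ⟦ P ⟧ × enc b ∈ ⟦ P ⟧
  both∈⟦⟧ P a b Pa Pb = ∈⟦⟧⁺ P a Pa , ∈⟦⟧⁺ P b Pb

  ∈⟦⟧⁻ : ∀ P u → u ∈ ⟦ P ⟧ → P (dec u) ≡ true
  ∈⟦⟧⁻ P u u∈P = trans (sym (Vecₚ.lookup∘tabulate (P ∘ dec) u)) (Vecₚ.[]=⇒lookup u∈P)

  IsCliqueᵛ : (V → Bool) → Set
  IsCliqueᵛ P = ∀ a b → P a ≡ true → P b ≡ true → a ≢ b → adjᵛ a b ≡ true

  ⟦⟧-clique : ∀ {P} → IsCliqueᵛ P → IsClique graph ⟦ P ⟧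
  ⟦⟧-clique {P} clq u v u∈P v∈P u≢v = clq (dec u) (dec v) (∈⟦⟧⁻ P u u∈P) (∈⟦⟧⁻ P v v∈P)
    (λ eq → u≢v (trans (sym (enc∘dec u)) (trans (cong enc eq) (enc∘dec v))))

  edge-clique : ∀ a b → adjᵛ a b ≡ true → IsClique graph (⁅ enc a ⁆ ∪ ⁅ enc b ⁆)
  edge-clique a b ab u v u∈ v∈ u≢v
    with x∈p∪q⁻ ⁅ enc a ⁆ ⁅ enc b ⁆ u∈ | x∈p∪q⁻ ⁅ enc a ⁆ ⁅ enc b ⁆ v∈
  ... | inj₁ u≡ | inj₁ v≡ = ⊥-elim (u≢v (trans (x∈⁅y⁆⇒x≡y _ u≡) (sym (x∈⁅y⁆⇒x≡y _ v≡))))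
  ... | inj₂ u≡ | inj₂ v≡ = ⊥-elim (u≢v (trans (x∈⁅y⁆⇒x≡y _ u≡) (sym (x∈⁅y⁆⇒x≡y _ v≡))))
  ... | inj₁ u≡ | inj₂ v≡ rewrite x∈⁅y⁆⇒x≡y _ u≡ | x∈⁅y⁆⇒x≡y _ v≡ = trans (adj-enc a b) ab
  ... | inj₂ u≡ | inj₁ v≡ rewrite x∈⁅y⁆⇒x≡y _ u≡ | x∈⁅y⁆⇒x≡y _ v≡ =
    trans (adj-enc b a) (trans (adjᵛ-sym b a) ab)

  covering-from : ∀ {𝒞} → All (IsClique graph) 𝒞 →
                  (∀ a b → adjᵛ a b ≡ true → Any (λ C → enc a ∈ C × enc b ∈ C) 𝒞) →
                  IsCliqueCovering graph 𝒞
  covering-from {𝒞} cliques covers = cliques , λ u v uv →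
    subst (λ u′ → Any (λ C → u′ ∈ C × v ∈ C) 𝒞) (enc∘dec u)
      (subst (λ v′ → Any (λ C → enc (dec u) ∈ C × v′ ∈ C) 𝒞) (enc∘dec v) (covers (dec u) (dec v) uv))

-- The graphs of the construction

_≡ᵇ_ : ∀ {k} → Fin k → Fin k → Bool
i ≡ᵇ j = does (i Fin.≟ j)

≡ᵇ-refl : ∀ {k} (i : Fin k) → (i ≡ᵇ i) ≡ true
≡ᵇ-refl i = dec-true (i Fin.≟ i) refl

≡ᵇ-sym : ∀ {k} (i j : Fin k) → (i ≡ᵇ j) ≡ (j ≡ᵇ i)
≡ᵇ-sym i j = does-⇔ (mk⇔ sym sym) (i Fin.≟ j) (j Fin.≟ i)

≡ᵇ⇒≡ : ∀ {k} (i j : Fin k) → (i ≡ᵇ j) ≡ true → i ≡ j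
≡ᵇ⇒≡ i j eq with i Fin.≟ j | eq
... | yes i≡j | _ = i≡j
... | no  _   | ()

≢⇒not-≡ᵇ : ∀ {k} {i j : Fin k} → i ≢ j → not (i ≡ᵇ j) ≡ true
≢⇒not-≡ᵇ {i = i} {j} i≢j = cong not (dec-false (i Fin.≟ j) i≢j)

module Construction (r m : ℕ) where

  K : ℕ
  K = suc (suc m)

  data Vertex : Set where
    vr     : Fin r → Vertex
    vx vy  : Fin K → Vertex

  joinedToR : Fin K → Bool
  joinedToR zero    = false
  joinedToR (suc _) = true

  adjᵛ : Vertex → Vertex → Bool
  adjᵛ (vr i) (vr j) = not (i ≡ᵇ j)
  adjᵛ (vx i) (vx j) = not (i ≡ᵇ j)
  adjᵛ (vy i) (vy j) = not (i ≡ᵇ j)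
  adjᵛ (vx i) (vy j) = i ≡ᵇ j
  adjᵛ (vy i) (vx j) = i ≡ᵇ j
  adjᵛ (vr _) (vx j) = joinedToR j
  adjᵛ (vx i) (vr _) = joinedToR i
  adjᵛ (vr _) (vy _) = true
  adjᵛ (vy _) (vr _) = true

  adjᵛ-sym : ∀ a b → adjᵛ a b ≡ adjᵛ b a
  adjᵛ-sym (vr i) (vr j) = cong not (≡ᵇ-sym i j)
  adjᵛ-sym (vx i) (vx j) = cong not (≡ᵇ-sym i j)
  adjᵛ-sym (vy i) (vy j) = cong not (≡ᵇ-sym i j)
  adjᵛ-sym (vx i) (vy j) = ≡ᵇ-sym i j
  adjᵛ-sym (vy i) (vx j) = ≡ᵇ-sym i j
  adjᵛ-sym (vr _) (vx _) = refl
  adjᵛ-sym (vx _) (vr _) = refl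
  adjᵛ-sym (vr _) (vy _) = refl
  adjᵛ-sym (vy _) (vr _) = refl

  adjᵛ-irrefl : ∀ a → adjᵛ a a ≡ false
  adjᵛ-irrefl (vr i) = cong not (≡ᵇ-refl i)
  adjᵛ-irrefl (vx i) = cong not (≡ᵇ-refl i)
  adjᵛ-irrefl (vy i) = cong not (≡ᵇ-refl i)

  N : ℕ
  N = r + (K + K)

  enc : Vertex → Fin N
  enc (vr i) = i ↑ˡ (K + K)
  enc (vx i) = r ↑ʳ (i ↑ˡ K)
  enc (vy i) = r ↑ʳ (K ↑ʳ i)

  dec : Fin N → Vertex
  dec u = [ vr , [ vx , vy ]′ ∘ splitAt K ]′ (splitAt r u)

  dec∘enc : ∀ a → dec (enc a) ≡ a
  dec∘enc (vr i) rewrite Finₚ.splitAt-↑ˡ r i (K + K) = refl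
  dec∘enc (vx i) rewrite Finₚ.splitAt-↑ʳ r (K + K) (i ↑ˡ K) | Finₚ.splitAt-↑ˡ K i K = refl
  dec∘enc (vy i) rewrite Finₚ.splitAt-↑ʳ r (K + K) (K ↑ʳ i) | Finₚ.splitAt-↑ʳ K K i = refl

  enc∘dec : ∀ u → enc (dec u) ≡ u
  enc∘dec u with splitAt r u | Finₚ.join-splitAt r (K + K) u
  ... | inj₁ _ | eq = eq
  ... | inj₂ w | eq = trans (enc∘decXY w) eq
    where
    enc∘decXY : ∀ w → enc ([ vx , vy ]′ (splitAt K w)) ≡ r ↑ʳ w
    enc∘decXY w with splitAt K w | Finₚ.join-splitAt K K w
    ... | inj₁ _ | eq = cong (r ↑ʳ_) eq
    ... | inj₂ _ | eq = cong (r ↑ʳ_) eq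

  open Presentation N enc dec dec∘enc enc∘dec adjᵛ adjᵛ-sym adjᵛ-irrefl public

  inX inR∪Y inR∪X⁺ : Vertex → Bool
  inX (vx _) = true
  inX _      = false
  inR∪Y (vx _) = false
  inR∪Y _      = true
  inR∪X⁺ (vr _) = true
  inR∪X⁺ (vx i) = joinedToR i
  inR∪X⁺ (vy _) = false

  spoke : Fin K → Vertex → Bool
  spoke c (vr _) = joinedToR c
  spoke c (vx i) = c ≡ᵇ i
  spoke c (vy i) = c ≡ᵇ i

  inX-clique : IsCliqueᵛ inX
  inX-clique (vx _) (vx _) _ _ a≢b = ≢⇒not-≡ᵇ (a≢b ∘ cong vx)
  inX-clique (vx _) (vr _) _ () _
  inX-clique (vx _) (vy _) _ () _
  inX-clique (vr _) _      () _ _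
  inX-clique (vy _) _      () _ _

  inR∪Y-clique : IsCliqueᵛ inR∪Y
  inR∪Y-clique (vr _) (vr _) _ _ a≢b = ≢⇒not-≡ᵇ (a≢b ∘ cong vr)
  inR∪Y-clique (vy _) (vy _) _ _ a≢b = ≢⇒not-≡ᵇ (a≢b ∘ cong vy)
  inR∪Y-clique (vr _) (vy _) _ _ _   = refl
  inR∪Y-clique (vy _) (vr _) _ _ _   = refl
  inR∪Y-clique (vx _) _      () _ _
  inR∪Y-clique (vr _) (vx _) _ () _
  inR∪Y-clique (vy _) (vx _) _ () _

  inR∪X⁺-clique : IsCliqueᵛ inR∪X⁺
  inR∪X⁺-clique (vr _) (vr _) _  _  a≢b = ≢⇒not-≡ᵇ (a≢b ∘ cong vr)
  inR∪X⁺-clique (vx _) (vx _) _  _  a≢b = ≢⇒not-≡ᵇ (a≢b ∘ cong vx)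
  inR∪X⁺-clique (vr _) (vx _) _  Pb _   = Pb
  inR∪X⁺-clique (vx _) (vr _) Pa _  _   = Pa
  inR∪X⁺-clique (vy _) _      () _  _
  inR∪X⁺-clique (vr _) (vy _) _  () _
  inR∪X⁺-clique (vx _) (vy _) _  () _

  spoke-clique : ∀ c → IsCliqueᵛ (spoke c)
  spoke-clique c (vr _) (vr _) _  _  a≢b = ≢⇒not-≡ᵇ (a≢b ∘ cong vr)
  spoke-clique c (vr _) (vy _) _  _  _   = refl
  spoke-clique c (vy _) (vr _) _  _  _   = refl
  spoke-clique c (vr _) (vx j) Pa Pb _   = subst (λ i → joinedToR i ≡ true) (≡ᵇ⇒≡ c j Pb) Pa
  spoke-clique c (vx i) (vr _) Pa Pb _   = subst (λ i → joinedToR i ≡ true) (≡ᵇ⇒≡ c i Pa) Pb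
  spoke-clique c (vx i) (vy j) Pa Pb _   = subst (λ i → (i ≡ᵇ j) ≡ true) (≡ᵇ⇒≡ c i Pa) Pb
  spoke-clique c (vy i) (vx j) Pa Pb _   = subst (λ i → (i ≡ᵇ j) ≡ true) (≡ᵇ⇒≡ c i Pa) Pb
  spoke-clique c (vx i) (vx j) Pa Pb a≢b = ⊥-elim (a≢b (cong vx (trans (sym (≡ᵇ⇒≡ c i Pa)) (≡ᵇ⇒≡ c j Pb))))
  spoke-clique c (vy i) (vy j) Pa Pb a≢b = ⊥-elim (a≢b (cong vy (trans (sym (≡ᵇ⇒≡ c i Pa)) (≡ᵇ⇒≡ c j Pb))))

  optimalCovering : List (Subset N)
  optimalCovering = ⟦ inX ⟧ ∷ ⟦ inR∪Y ⟧ ∷ tabulate (⟦_⟧ ∘ spoke)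

  optimalCovering-length : length optimalCovering ≡ suc (suc K)
  optimalCovering-length = cong (2 +_) (length-tabulate (⟦_⟧ ∘ spoke))

  optimalCovering-covering : IsCliqueCovering graph optimalCovering
  optimalCovering-covering = covering-from
    (⟦⟧-clique inX-clique ∷ ⟦⟧-clique inR∪Y-clique ∷ Allₚ.tabulate⁺ (⟦⟧-clique ∘ spoke-clique)) covers
    where
    inSpoke : ∀ c a b → spoke c a ≡ true → spoke c b ≡ true →
              Any (λ C → enc a ∈ C × enc b ∈ C) optimalCovering
    inSpoke c a b Pa Pb = there (there (Anyₚ.tabulate⁺ {f = ⟦_⟧ ∘ spoke} c (both∈⟦⟧ (spoke c) a b Pa Pb)))

    covers : ∀ a b → adjᵛ a b ≡ true → Any (λ C → enc a ∈ C × enc b ∈ C) optimalCovering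
    covers (vx i) (vx j) _  = here (both∈⟦⟧ inX (vx i) (vx j) refl refl)
    covers (vr i) (vr j) _  = there (here (both∈⟦⟧ inR∪Y (vr i) (vr j) refl refl))
    covers (vr i) (vy j) _  = there (here (both∈⟦⟧ inR∪Y (vr i) (vy j) refl refl))
    covers (vy i) (vr j) _  = there (here (both∈⟦⟧ inR∪Y (vy i) (vr j) refl refl))
    covers (vy i) (vy j) _  = there (here (both∈⟦⟧ inR∪Y (vy i) (vy j) refl refl))
    covers (vr i) (vx j) ab = inSpoke j (vr i) (vx j) ab (≡ᵇ-refl j)
    covers (vx i) (vr j) ab = inSpoke i (vx i) (vr j) (≡ᵇ-refl i) ab
    covers (vx i) (vy j) ab = inSpoke i (vx i) (vy j) (≡ᵇ-refl i) ab
    covers (vy i) (vx j) ab = inSpoke j (vy i) (vx j) (trans (≡ᵇ-sym j i) ab) (≡ᵇ-refl j)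

  matchingEdge : Fin K → Subset N
  matchingEdge i = ⁅ enc (vx i) ⁆ ∪ ⁅ enc (vy i) ⁆

  cheapCovering : List (Subset N)
  cheapCovering = ⟦ inR∪Y ⟧ ∷ ⟦ inR∪X⁺ ⟧ ∷ ⟦ inX ⟧ ∷ tabulate matchingEdge

  cheapCovering-covering : IsCliqueCovering graph cheapCovering
  cheapCovering-covering = covering-from
    (⟦⟧-clique inR∪Y-clique ∷ ⟦⟧-clique inR∪X⁺-clique ∷ ⟦⟧-clique inX-clique ∷
     Allₚ.tabulate⁺ (λ i → edge-clique (vx i) (vy i) (≡ᵇ-refl i))) covers
    where
    covers : ∀ a b → adjᵛ a b ≡ true → Any (λ C → enc a ∈ C × enc b ∈ C) cheapCovering
    covers (vr i) (vr j) _  = here (both∈⟦⟧ inR∪Y (vr i) (vr j) refl refl)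
    covers (vr i) (vy j) _  = here (both∈⟦⟧ inR∪Y (vr i) (vy j) refl refl)
    covers (vy i) (vr j) _  = here (both∈⟦⟧ inR∪Y (vy i) (vr j) refl refl)
    covers (vy i) (vy j) _  = here (both∈⟦⟧ inR∪Y (vy i) (vy j) refl refl)
    covers (vr i) (vx j) ab = there (here (both∈⟦⟧ inR∪X⁺ (vr i) (vx j) refl ab))
    covers (vx i) (vr j) ab = there (here (both∈⟦⟧ inR∪X⁺ (vx i) (vr j) ab refl))
    covers (vx i) (vx j) _  = there (there (here (both∈⟦⟧ inX (vx i) (vx j) refl refl)))
    covers (vx i) (vy j) ab with refl ← ≡ᵇ⇒≡ i j ab = there (there (there (Anyₚ.tabulate⁺ {f = matchingEdge} j
      (x∈p∪q⁺ (inj₁ (x∈⁅x⁆ _)) , x∈p∪q⁺ (inj₂ (x∈⁅x⁆ _))))))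
    covers (vy i) (vx j) ab with refl ← ≡ᵇ⇒≡ i j ab = there (there (there (Anyₚ.tabulate⁺ {f = matchingEdge} j
      (x∈p∪q⁺ (inj₂ (x∈⁅x⁆ _)) , x∈p∪q⁺ (inj₁ (x∈⁅x⁆ _))))))

  cheapCovering-weight : weight cheapCovering ≤ 3 * N + 2 * K
  cheapCovering-weight = begin
    weight cheapCovering
      ≤⟨ +-mono-≤ (∣p∣≤n ⟦ inR∪Y ⟧) (+-mono-≤ (∣p∣≤n ⟦ inR∪X⁺ ⟧) (+-mono-≤ (∣p∣≤n ⟦ inX ⟧)
           (weight-tabulate-≤ matchingEdge ∣matchingEdge∣≤2))) ⟩
    N + (N + (N + K * 2))
      ≡⟨ collect N K ⟩
    3 * N + 2 * K ∎
    where
    open ≤-Reasoning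
    collect : ∀ n k → n + (n + (n + k * 2)) ≡ 3 * n + 2 * k
    collect = solve-∀
    ∣matchingEdge∣≤2 : ∀ i → ∣ matchingEdge i ∣ ≤ 2
    ∣matchingEdge∣≤2 i = ≤-trans (∣p∪q∣≤∣p∣+∣q∣ ⁅ enc (vx i) ⁆ ⁅ enc (vy i) ⁆)
      (≤-reflexive (cong₂ _+_ (∣⁅x⁆∣≡1 (enc (vx i))) (∣⁅x⁆∣≡1 (enc (vy i)))))

  module _ {𝒞 : List (Subset N)} (cov : IsCliqueCovering graph 𝒞) where

    _∈ᶜ_ : Vertex → Fin (length 𝒞) → Set
    a ∈ᶜ j = enc a ∈ lookup 𝒞 j

    shared : ∀ a b → adjᵛ a b ≡ true → Σ[ j ∈ Fin (length 𝒞) ] (a ∈ᶜ j × b ∈ᶜ j)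
    shared a b ab = shared-clique graph cov (trans (adj-enc a b) ab)

    together⇒adjacent : ∀ a b j → a ∈ᶜ j → b ∈ᶜ j → a ≢ b → adjᵛ a b ≡ true
    together⇒adjacent a b j a∈j b∈j a≢b =
      trans (sym (adj-enc a b)) (same-clique⇒adjacent graph cov j a∈j b∈j (enc-injective a≢b))

    xy-together⇒≡ : ∀ {i i′} j → vx i ∈ᶜ j → vy i′ ∈ᶜ j → i ≡ i′
    xy-together⇒≡ {i} {i′} j x∈j y∈j = ≡ᵇ⇒≡ i i′ (together⇒adjacent (vx i) (vy i′) j x∈j y∈j λ ())

    x₀x₁ y₀y₁ : Fin (length 𝒞)
    x₀x₁ = proj₁ (shared (vx zero) (vx (suc zero)) refl)
    y₀y₁ = proj₁ (shared (vy zero) (vy (suc zero)) refl)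

    x₀∈x₀x₁ : vx zero ∈ᶜ x₀x₁
    x₀∈x₀x₁ = proj₁ (proj₂ (shared (vx zero) (vx (suc zero)) refl))
    x₁∈x₀x₁ : vx (suc zero) ∈ᶜ x₀x₁
    x₁∈x₀x₁ = proj₂ (proj₂ (shared (vx zero) (vx (suc zero)) refl))
    y₀∈y₀y₁ : vy zero ∈ᶜ y₀y₁
    y₀∈y₀y₁ = proj₁ (proj₂ (shared (vy zero) (vy (suc zero)) refl))
    y₁∈y₀y₁ : vy (suc zero) ∈ᶜ y₀y₁
    y₁∈y₀y₁ = proj₂ (proj₂ (shared (vy zero) (vy (suc zero)) refl))

    xy : Fin K → Fin (length 𝒞)
    xy i = proj₁ (shared (vx i) (vy i) (≡ᵇ-refl i))

    x∈xy : ∀ i → vx i ∈ᶜ xy i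
    x∈xy i = proj₁ (proj₂ (shared (vx i) (vy i) (≡ᵇ-refl i)))
    y∈xy : ∀ i → vy i ∈ᶜ xy i
    y∈xy i = proj₂ (proj₂ (shared (vx i) (vy i) (≡ᵇ-refl i)))

    xy-injective : Injective _≡_ _≡_ xy
    xy-injective {i} {i′} eq = xy-together⇒≡ (xy i′) (subst (vx i ∈ᶜ_) eq (x∈xy i)) (y∈xy i′)

    xy≢x₀x₁ : ∀ i → xy i ≢ x₀x₁
    xy≢x₀x₁ i eq = Finₚ.0≢1+n (trans (xy-together⇒≡ x₀x₁ x₀∈x₀x₁ yᵢ∈) (sym (xy-together⇒≡ x₀x₁ x₁∈x₀x₁ yᵢ∈)))
      where yᵢ∈ = subst (vy i ∈ᶜ_) eq (y∈xy i)

    xy≢y₀y₁ : ∀ i → xy i ≢ y₀y₁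
    xy≢y₀y₁ i eq = Finₚ.0≢1+n (trans (sym (xy-together⇒≡ y₀y₁ xᵢ∈ y₀∈y₀y₁)) (xy-together⇒≡ y₀y₁ xᵢ∈ y₁∈y₀y₁))
      where xᵢ∈ = subst (vx i ∈ᶜ_) eq (x∈xy i)

    x₀x₁≢y₀y₁ : x₀x₁ ≢ y₀y₁
    x₀x₁≢y₀y₁ eq = Finₚ.0≢1+n (xy-together⇒≡ y₀y₁ (subst (vx zero ∈ᶜ_) eq x₀∈x₀x₁) y₁∈y₀y₁)

    index : Fin (suc (suc K)) → Fin (length 𝒞)
    index zero          = x₀x₁
    index (suc zero)    = y₀y₁
    index (suc (suc i)) = xy i

    index-injective : Injective _≡_ _≡_ index
    index-injective {zero}        {zero}         _  = refl
    index-injective {suc zero}    {suc zero}     _  = refl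
    index-injective {suc (suc i)} {suc (suc i′)} eq = cong (Fin.suc ∘ Fin.suc) (xy-injective eq)
    index-injective {zero}        {suc zero}     eq = ⊥-elim (x₀x₁≢y₀y₁ eq)
    index-injective {suc zero}    {zero}         eq = ⊥-elim (x₀x₁≢y₀y₁ (sym eq))
    index-injective {zero}        {suc (suc i)}  eq = ⊥-elim (xy≢x₀x₁ i (sym eq))
    index-injective {suc (suc i)} {zero}         eq = ⊥-elim (xy≢x₀x₁ i eq)
    index-injective {suc zero}    {suc (suc i)}  eq = ⊥-elim (xy≢y₀y₁ i (sym eq))
    index-injective {suc (suc i)} {suc zero}     eq = ⊥-elim (xy≢y₀y₁ i eq)

    covering-length-≥ : suc (suc K) ≤ length 𝒞
    covering-length-≥ = Finₚ.injective⇒≤ index-injective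

    module _ (tight : length 𝒞 ≤ suc (suc K)) where

      -- A tight covering consists exactly of the cliques enumerated by index, and among them only
      -- the clique of xᵢyᵢ can contain the edge ρxᵢ.
      R⊆xy : ∀ ρ i → vr ρ ∈ᶜ xy (suc i)
      R⊆xy ρ i with shared (vr ρ) (vx (suc i)) refl
      ... | j , ρ∈j , x∈j with injective⇒surjective index index-injective tight j
      ... | zero        , refl with () ← together⇒adjacent (vr ρ) (vx zero) x₀x₁ ρ∈j x₀∈x₀x₁ (λ ())
      ... | suc zero    , refl with () ← xy-together⇒≡ y₀y₁ x∈j y₀∈y₀y₁
      ... | suc (suc p) , refl = subst (λ q → vr ρ ∈ᶜ xy q) (sym (xy-together⇒≡ (xy p) x∈j (y∈xy p))) ρ∈j

      tight-weight-≥ : suc m * r ≤ weight 𝒞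
      tight-weight-≥ = begin
        suc m * r
          ≤⟨ *≤sum (λ i → ∣ lookup 𝒞 (xy (suc i)) ∣) (λ i → ↑ˡ-all∈⇒m≤∣p∣ _ (λ ρ → R⊆xy ρ i)) ⟩
        sum (λ i → ∣ lookup 𝒞 (xy (suc i)) ∣)
          ≤⟨ sum-injective-≤ (λ j → ∣ lookup 𝒞 j ∣) (xy ∘ suc) (Finₚ.suc-injective ∘ xy-injective) ⟩
        sum (λ j → ∣ lookup 𝒞 j ∣)
          ≡⟨ weight≡sum 𝒞 ⟨
        weight 𝒞 ∎
        where open ≤-Reasoning

module Instance (n : ℕ) where

  open Construction (suc n) n public

  cc : IsCC graph (suc (suc K))
  cc = (optimalCovering , optimalCovering-covering , optimalCovering-length) , λ _ → covering-length-≥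

  -- Opaque: unfolding them would run the exhaustive searches of scc-exists and scc'-exists.
  opaque
    scc : Σ ℕ (IsSCC graph)
    scc = scc-exists graph cheapCovering-covering

    scc' : Σ ℕ (IsSCC' graph)
    scc' = scc'-exists graph cc

  scc-positive : 0 < proj₁ scc
  scc-positive with proj₁ (proj₂ scc)
  ... | _ , cov , w =
    subst (0 <_) w (weight-positive graph cov (enc x₀) (enc x₁) (adj-enc x₀ x₁))
    where x₀ = vx zero
          x₁ = vx (suc zero)

  scc-≤ : proj₁ scc ≤ 19 * suc n
  scc-≤ = begin
    proj₁ scc             ≤⟨ proj₂ (proj₂ scc) _ cheapCovering-covering ⟩
    weight cheapCovering  ≤⟨ cheapCovering-weight ⟩
    3 * N + 2 * K         ≤⟨ m≤m+n (3 * N + 2 * K) (8 * n) ⟩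
    3 * N + 2 * K + 8 * n ≡⟨ collect n ⟩
    19 * suc n            ∎
    where
    open ≤-Reasoning
    collect : ∀ n → 3 * (suc n + (suc (suc n) + suc (suc n))) + 2 * suc (suc n) + 8 * n ≡ 19 * suc n
    collect = solve-∀

  scc'-≥ : suc n * suc n ≤ proj₁ scc'
  scc'-≥ with scc'-witness graph (proj₂ scc') optimalCovering-covering
  ... | 𝒞 , cov , short , w =
    subst (suc n * suc n ≤_) w (tight-weight-≥ cov (subst (length 𝒞 ≤_) optimalCovering-length short))

theorem1 : Σ[ G ∈ (ℕ → Graph) ] Σ[ s ∈ (ℕ → ℕ) ] Σ[ s' ∈ (ℕ → ℕ) ]
             ((∀ n → 1 ≤ n → IsSCC (G n) (s n) × IsSCC' (G n) (s' n) × 0 < s n) ×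
              (∀ (M : ℕ) → Σ[ N ∈ ℕ ] (∀ n → 1 ≤ n → N ≤ n → M * s n ≤ s' n)))
theorem1 =
  Instance.graph , proj₁ ∘ Instance.scc , proj₁ ∘ Instance.scc' ,
  (λ n _ → proj₂ (Instance.scc n) , proj₂ (Instance.scc' n) , Instance.scc-positive n) ,
  λ M → 19 * M , λ n _ 19M≤n → begin
    M * proj₁ (Instance.scc n) ≤⟨ *-monoʳ-≤ M (Instance.scc-≤ n) ⟩
    M * (19 * suc n)           ≡⟨ *-assoc M 19 (suc n) ⟨
    M * 19 * suc n             ≡⟨ cong (_* suc n) (*-comm M 19) ⟩
    19 * M * suc n             ≤⟨ *-monoˡ-≤ (suc n) (m≤n⇒m≤1+n 19M≤n) ⟩
    suc n * suc n              ≤⟨ Instance.scc'-≥ n ⟩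
    proj₁ (Instance.scc' n)    ∎
  where open ≤-Reasoning
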